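{- Let $G=(V,E,w)$ be a directed graph with positive vertex weights $w:V\to\mathbb{Z}^+$, and let $G'=(V',E',w')$ be the undirected graph with $V'=V_{\mathrm{out}}\cup V_{\mathrm{in}}$ (two disjoint copies $\{v_{\mathrm{out}}:v\in V\}$ and $\{v_{\mathrm{in}}:v\in V\}$ of $V$), whose edges are a clique on $V_{\mathrm{out}}$, a clique on $V_{\mathrm{in}}$, the edges $\{v_{\mathrm{out}},v_{\mathrm{in}}\}$ for $v\in V$, and the edges $\{u_{\mathrm{out}},v_{\mathrm{in}}\}$ for $(u,v)\in E$, with weights $w'(v_{\mathrm{out}})=w'(v_{\mathrm{in}})=w(v)$. Let $\emptyset\neq R_{\mathrm{in}}\subseteq V_{\mathrm{in}}$ and $R=\{v\in V:v_{\mathrm{in}}\in R_{\mathrm{in}}\}$. Then $w'(N_{G'}(R_{\mathrm{in}}))=w(N^{\mathrm{in}}_G(R))+w(V)$.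
   Context: For a vertex set $X$, $w(X)=\sum_{v\in X}w(v)$. For an undirected graph $H$ and a vertex set $X$, $N_H(X)$ is the set of vertices not in $X$ that are adjacent to some vertex of $X$. For a directed graph $G$ and $R\subseteq V$, $N^{\mathrm{in}}_G(R)=\{u\in V\setminus R:\ (u,v)\in E \text{ for some } v\in R\}$ is the in-neighborhood of $R$. -}

module Defs where

open import Data.Nat using (ℕ; _+_)
open import Data.Bool using (Bool; true; false; _∧_; _∨_; not; if_then_else_)
open import Data.Fin using (Fin; _↑ˡ_; _↑ʳ_; splitAt; _≟_)
open import Data.Fin.Subset using (Subset)
open import Data.List using (List; map; allFin)
open import Data.Bool.ListAction using (any)
open import Data.Nat.ListAction using (sum)
open import Data.Vec using (lookup; tabulate)
open import Data.Sum using (inj₁; inj₂)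
open import Relation.Nullary.Decidable using (⌊_⌋)

-- A directed graph: E u v = true iff (u , v) ∈ E.
-- An undirected graph: a symmetric adjacency adj x y = true iff {x , y} is an edge.

anyFin : {m : ℕ} → (Fin m → Bool) → Bool
anyFin {m} p = any p (allFin m)

weight : {m : ℕ} → (Fin m → ℕ) → Subset m → ℕ
weight {m} w X = sum (map (λ v → if lookup X v then w v else 0) (allFin m))

fullSet : (m : ℕ) → Subset m
fullSet m = tabulate (λ _ → true)

nbhd : {m : ℕ} → (Fin m → Fin m → Bool) → Subset m → Subset m
nbhd adj X = tabulate (λ y → not (lookup X y) ∧ anyFin (λ x → lookup X x ∧ adj x y))

inNbhd : {n : ℕ} → (Fin n → Fin n → Bool) → Subset n → Subset n
inNbhd E R = tabulate (λ u → not (lookup R u) ∧ anyFin (λ v → lookup R v ∧ E u v))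

-- The split graph G' on V' = V_out ∪ V_in, encoded as Fin (n + n):
-- v_out = v ↑ˡ n (first block), v_in = n ↑ʳ v (second block).
vOut : {n : ℕ} → Fin n → Fin (n + n)
vOut {n} v = v ↑ˡ n

vIn : {n : ℕ} → Fin n → Fin (n + n)
vIn {n} v = n ↑ʳ v

eqb : {n : ℕ} → Fin n → Fin n → Bool
eqb u v = ⌊ u ≟ v ⌋

splitAdj : {n : ℕ} → (Fin n → Fin n → Bool) → Fin (n + n) → Fin (n + n) → Bool
splitAdj {n} E a b with splitAt n a | splitAt n b
... | inj₁ u | inj₁ v = not (eqb u v)
... | inj₂ u | inj₂ v = not (eqb u v)
... | inj₁ u | inj₂ v = eqb u v ∨ E u v
... | inj₂ u | inj₁ v = eqb v u ∨ E v u

splitWeight : {n : ℕ} → (Fin n → ℕ) → Fin (n + n) → ℕ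
splitWeight {n} w a with splitAt n a
... | inj₁ v = w v
... | inj₂ v = w v

projIn : {n : ℕ} → Subset (n + n) → Subset n
projIn Rin = tabulate (λ v → lookup Rin (vIn v))

{-# OPTIONS --safe #-}
-- Because R_in ⊆ V_in, membership in N_G'(R_in) can be decided vertex by vertex: v_in
-- belongs to it iff v ∉ R (V_in is a clique and R ≠ ∅), and v_out iff v ∈ R (via the edge
-- {v_out, v_in}) or v ∈ N^in(R) (via an edge {v_out, u_in} with (v, u) ∈ E).  As R and N^in(R)
-- are disjoint, the two copies of v together contribute w(v)·[v ∈ N^in(R)] + w(v).
module Submission where

open import Defs
open import Algebra.Bundles using (Monoid; CommutativeMonoid)
import Algebra.Properties.Monoid.Sum as MonoidSum
import Algebra.Properties.CommutativeMonoid.Sum as CommutativeMonoidSum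
open import Data.Bool using (Bool; true; false; _∧_; _∨_; not; if_then_else_)
open import Data.Bool.Properties using (∨-commutativeMonoid)
open import Data.Nat using (ℕ; zero; suc; _+_; _<_)
open import Data.Nat.Properties using (+-0-monoid; +-0-commutativeMonoid; +-comm)
open import Data.Fin using (Fin; zero; suc; _↑ˡ_; _↑ʳ_; splitAt; _≟_)
open import Data.Fin.Properties using (splitAt-↑ˡ; splitAt-↑ʳ)
open import Data.Fin.Subset using (Subset; _∈_; Nonempty)
open import Data.List using (foldr; map; tabulate; allFin)
open import Data.List.Properties using (map-tabulate; map-cong)
open import Data.Bool.ListAction using (or)
open import Data.Vec using (lookup)
open import Data.Vec.Properties using (lookup∘tabulate; []=⇒lookup; lookup⇒[]=)
open import Data.Vec.Functional using (Vector; removeAt)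
open import Data.Product using (∃; _,_)
open import Function using (_∘_; id)
open import Relation.Nullary using (contradiction)
open import Relation.Nullary.Decidable using (isYes≗does; dec-true; dec-false)
open import Relation.Binary.PropositionalEquality
  using (_≡_; _≢_; _≗_; refl; sym; trans; cong; cong₂; module ≡-Reasoning)

module _ {a ℓ} (M : Monoid a ℓ) where
  open Monoid M using (Carrier; _≈_; _∙_; ε; setoid; assoc; identityˡ; ∙-congˡ)
  open MonoidSum M using (sum)
  open import Relation.Binary.Reasoning.Setoid setoid

  sum-↑ : ∀ m {n} (t : Vector Carrier (m + n)) →
          sum t ≈ sum (t ∘ (_↑ˡ n)) ∙ sum (t ∘ (m ↑ʳ_))
  sum-↑ zero    t = begin sum t ≈⟨ identityˡ (sum t) ⟨ ε ∙ sum t ∎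
  sum-↑ (suc m) {n} t = begin
    t zero ∙ sum (t ∘ suc)                                       ≈⟨ ∙-congˡ (sum-↑ m (t ∘ suc)) ⟩
    t zero ∙ (sum (t ∘ suc ∘ (_↑ˡ n)) ∙ sum (t ∘ suc ∘ (m ↑ʳ_))) ≈⟨ assoc _ _ _ ⟨
    (t zero ∙ sum (t ∘ suc ∘ (_↑ˡ n))) ∙ sum (t ∘ suc ∘ (m ↑ʳ_)) ∎

  foldr-tabulate : ∀ {m} (t : Vector Carrier m) → foldr _∙_ ε (tabulate t) ≡ sum t
  foldr-tabulate {zero}  t = refl
  foldr-tabulate {suc m} t = cong (t zero ∙_) (foldr-tabulate (t ∘ suc))

  foldr-map-allFin : ∀ {m} (t : Vector Carrier m) → foldr _∙_ ε (map t (allFin m)) ≡ sum t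
  foldr-map-allFin {m} t = trans (cong (foldr _∙_ ε) (map-tabulate id t)) (foldr-tabulate t)

module ℕ-Sum = CommutativeMonoidSum +-0-commutativeMonoid
module ∨-Sum = CommutativeMonoidSum ∨-commutativeMonoid

∨-monoid : Monoid _ _
∨-monoid = CommutativeMonoid.monoid ∨-commutativeMonoid

open ℕ-Sum using () renaming (sum to ∑)
open ∨-Sum using () renaming (sum to ⋁)

open ≡-Reasoning

mask : Bool → ℕ → ℕ
mask b k = if b then k else 0

restrict : ∀ {m} → (Fin m → ℕ) → Subset m → Fin m → ℕ
restrict w X v = mask (lookup X v) (w v)

weight≡∑restrict : ∀ {m} (w : Fin m → ℕ) (X : Subset m) → weight w X ≡ ∑ (restrict w X)
weight≡∑restrict w X = foldr-map-allFin +-0-monoid (restrict w X)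

anyFin≡⋁ : ∀ {m} (p : Fin m → Bool) → anyFin p ≡ ⋁ p
anyFin≡⋁ = foldr-map-allFin ∨-monoid

anyFin-cong : ∀ {m} {p q : Fin m → Bool} → p ≗ q → anyFin p ≡ anyFin q
anyFin-cong {m} p≗q = cong or (map-cong p≗q (allFin m))

anyFin-witness : ∀ {m} (p : Fin m → Bool) (v : Fin m) → p v ≡ true → anyFin p ≡ true
anyFin-witness {suc m} p v pv = begin
  anyFin p                 ≡⟨ anyFin≡⋁ p ⟩
  ⋁ p                      ≡⟨ ∨-Sum.sum-remove {i = v} p ⟩
  p v ∨ ⋁ (removeAt p v)   ≡⟨ cong (_∨ ⋁ (removeAt p v)) pv ⟩
  true                     ∎

anyFin-↑ʳ : ∀ m {n} (p : Fin (m + n) → Bool) → (∀ i → p (i ↑ˡ n) ≡ false) →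
            anyFin p ≡ anyFin (p ∘ (m ↑ʳ_))
anyFin-↑ʳ m {n} p p↑ˡ≡false = begin
  anyFin p                            ≡⟨ anyFin≡⋁ p ⟩
  ⋁ p                                 ≡⟨ sum-↑ ∨-monoid m p ⟩
  ⋁ (p ∘ (_↑ˡ n)) ∨ ⋁ (p ∘ (m ↑ʳ_))   ≡⟨ cong (_∨ ⋁ (p ∘ (m ↑ʳ_))) ⋁p↑ˡ≡false ⟩
  ⋁ (p ∘ (m ↑ʳ_))                     ≡⟨ anyFin≡⋁ (p ∘ (m ↑ʳ_)) ⟨
  anyFin (p ∘ (m ↑ʳ_))                ∎
  where
  ⋁p↑ˡ≡false : ⋁ (p ∘ (_↑ˡ n)) ≡ false
  ⋁p↑ˡ≡false = trans (∨-Sum.sum-cong-≗ p↑ˡ≡false) (∨-Sum.sum-replicate-zero m)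

eqb-refl : ∀ {m} (v : Fin m) → eqb v v ≡ true
eqb-refl v = trans (isYes≗does (v ≟ v)) (dec-true (v ≟ v) refl)

eqb-≢ : ∀ {m} {u v : Fin m} → u ≢ v → eqb u v ≡ false
eqb-≢ {u = u} {v} u≢v = trans (isYes≗does (u ≟ v)) (dec-false (u ≟ v) u≢v)

separated : ∀ {A : Set} (p : A → Bool) {x y : A} → p x ≡ true → p y ≡ false → x ≢ y
separated p px py refl with () ← trans (sym px) py

anyFin-eqb-∨ : ∀ {m} (p q : Fin m → Bool) (v : Fin m) →
               anyFin (λ u → p u ∧ (eqb v u ∨ q u))
                 ≡ p v ∨ (not (p v) ∧ anyFin (λ u → p u ∧ q u))
anyFin-eqb-∨ p q v with p v in pv
... | true  = anyFin-witness _ v (cong₂ _∧_ pv (cong (_∨ q v) (eqb-refl v)))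
... | false = anyFin-cong drop-v
  where
  drop-v : ∀ u → p u ∧ (eqb v u ∨ q u) ≡ p u ∧ q u
  drop-v u with p u in pu
  ... | false = refl
  ... | true  = cong (_∨ q u) (eqb-≢ (separated p pu pv ∘ sym))

anyFin-≢ : ∀ {m} (p : Fin m → Bool) {u₀ : Fin m} → p u₀ ≡ true → ∀ v →
           not (p v) ∧ anyFin (λ u → p u ∧ not (eqb u v)) ≡ not (p v)
anyFin-≢ p {u₀} pu₀ v with p v in pv
... | true  = refl
... | false = anyFin-witness _ u₀ (cong₂ _∧_ pu₀ (cong not (eqb-≢ (separated p pu₀ pv))))

lookup-fullSet : ∀ {m} (v : Fin m) → lookup (fullSet m) v ≡ true
lookup-fullSet v = lookup∘tabulate _ v

inNbhd-disjoint : ∀ {m} (E : Fin m → Fin m → Bool) (R : Subset m) v →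
                  lookup R v ≡ true → lookup (inNbhd E R) v ≡ false
inNbhd-disjoint E R v v∈R =
  trans (lookup∘tabulate _ v) (cong (λ b → not b ∧ anyFin (λ u → lookup R u ∧ E v u)) v∈R)

vOut≢vIn : ∀ {n} (u v : Fin n) → vOut u ≢ vIn v
vOut≢vIn {n} u v eq
  with () ← trans (sym (splitAt-↑ˡ n u n)) (trans (cong (splitAt n) eq) (splitAt-↑ʳ n n v))

module _ {n : ℕ} (E : Fin n → Fin n → Bool) where

  splitAdj-vIn-vOut : ∀ u v → splitAdj E (vIn u) (vOut v) ≡ eqb v u ∨ E v u
  splitAdj-vIn-vOut u v rewrite splitAt-↑ʳ n n u | splitAt-↑ˡ n v n = refl

  splitAdj-vIn-vIn : ∀ u v → splitAdj E (vIn u) (vIn v) ≡ not (eqb u v)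
  splitAdj-vIn-vIn u v rewrite splitAt-↑ʳ n n u | splitAt-↑ʳ n n v = refl

module _ {n : ℕ} (w : Fin n → ℕ) where

  splitWeight-vOut : ∀ v → splitWeight w (vOut v) ≡ w v
  splitWeight-vOut v rewrite splitAt-↑ˡ n v n = refl

  splitWeight-vIn : ∀ v → splitWeight w (vIn v) ≡ w v
  splitWeight-vIn v rewrite splitAt-↑ʳ n n v = refl

mask-∨-not : ∀ (r i : Bool) (k : ℕ) → (r ≡ true → i ≡ false) →
             mask (r ∨ i) k + mask (not r) k ≡ mask i k + k
mask-∨-not true  i k r⇒¬i rewrite r⇒¬i refl = +-comm k 0
mask-∨-not false i k r⇒¬i = refl

module SplitGraph {n : ℕ} (E : Fin n → Fin n → Bool) (Rin : Subset (n + n))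
                  (Rin⊆Vin : ∀ a → a ∈ Rin → ∃ λ v → a ≡ vIn {n} v) where

  R : Subset n
  R = projIn Rin

  lookup-R : ∀ v → lookup R v ≡ lookup Rin (vIn v)
  lookup-R v = lookup∘tabulate _ v

  vOut∉Rin : ∀ (v : Fin n) → lookup Rin (vOut v) ≡ false
  vOut∉Rin v with lookup Rin (vOut v) in vOut∈Rin
  ... | false = refl
  ... | true with u , vOut≡vIn ← Rin⊆Vin (vOut v) (lookup⇒[]= (vOut v) Rin vOut∈Rin)
    = contradiction vOut≡vIn (vOut≢vIn v u)

  anyFin-Rin : ∀ (p : Fin (n + n) → Bool) →
               anyFin (λ a → lookup Rin a ∧ p a) ≡ anyFin (λ v → lookup R v ∧ p (vIn v))
  anyFin-Rin p = trans (anyFin-↑ʳ n _ (λ v → cong (_∧ p (vOut v)) (vOut∉Rin v)))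
                       (anyFin-cong (λ v → cong (_∧ p (vIn v)) (sym (lookup-R v))))

  N : Subset (n + n)
  N = nbhd (splitAdj E) Rin

  lookup-N : ∀ a →
             lookup N a ≡ not (lookup Rin a) ∧ anyFin (λ v → lookup R v ∧ splitAdj E (vIn v) a)
  lookup-N a = trans (lookup∘tabulate _ a) (cong (not (lookup Rin a) ∧_) (anyFin-Rin _))

  lookup-N-vOut : ∀ (v : Fin n) → lookup N (vOut v) ≡ lookup R v ∨ lookup (inNbhd E R) v
  lookup-N-vOut v = begin
    lookup N (vOut v)
      ≡⟨ lookup-N (vOut v) ⟩
    not (lookup Rin (vOut v)) ∧ anyFin (λ u → lookup R u ∧ splitAdj E (vIn u) (vOut v))
      ≡⟨ cong₂ (λ b c → not b ∧ c) (vOut∉Rin v)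
               (anyFin-cong (λ u → cong (lookup R u ∧_) (splitAdj-vIn-vOut E u v))) ⟩
    anyFin (λ u → lookup R u ∧ (eqb v u ∨ E v u))
      ≡⟨ anyFin-eqb-∨ (lookup R) (E v) v ⟩
    lookup R v ∨ (not (lookup R v) ∧ anyFin (λ u → lookup R u ∧ E v u))
      ≡⟨ cong (lookup R v ∨_) (lookup∘tabulate _ v) ⟨
    lookup R v ∨ lookup (inNbhd E R) v ∎

  lookup-N-vIn : ∀ {u₀} → lookup R u₀ ≡ true →
                 ∀ (v : Fin n) → lookup N (vIn v) ≡ not (lookup R v)
  lookup-N-vIn u₀∈R v = begin
    lookup N (vIn v)
      ≡⟨ lookup-N (vIn v) ⟩
    not (lookup Rin (vIn v)) ∧ anyFin (λ u → lookup R u ∧ splitAdj E (vIn u) (vIn v))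
      ≡⟨ cong₂ (λ b c → not b ∧ c) (sym (lookup-R v))
               (anyFin-cong (λ u → cong (lookup R u ∧_) (splitAdj-vIn-vIn E u v))) ⟩
    not (lookup R v) ∧ anyFin (λ u → lookup R u ∧ not (eqb u v))
      ≡⟨ anyFin-≢ (lookup R) u₀∈R v ⟩
    not (lookup R v) ∎

  module _ (w : Fin n → ℕ) {u₀ : Fin n} (u₀∈R : lookup R u₀ ≡ true) where

    restrict-vOut+vIn : ∀ (v : Fin n) →
      restrict (splitWeight w) N (vOut v) + restrict (splitWeight w) N (vIn v)
        ≡ restrict w (inNbhd E R) v + restrict w (fullSet n) v
    restrict-vOut+vIn v = begin
      restrict (splitWeight w) N (vOut v) + restrict (splitWeight w) N (vIn v)
        ≡⟨ cong₂ _+_ (cong₂ mask (lookup-N-vOut v) (splitWeight-vOut w v))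
                     (cong₂ mask (lookup-N-vIn u₀∈R v) (splitWeight-vIn w v)) ⟩
      mask (lookup R v ∨ lookup (inNbhd E R) v) (w v) + mask (not (lookup R v)) (w v)
        ≡⟨ mask-∨-not (lookup R v) (lookup (inNbhd E R) v) (w v) (inNbhd-disjoint E R v) ⟩
      mask (lookup (inNbhd E R) v) (w v) + w v
        ≡⟨ cong (restrict w (inNbhd E R) v +_) (cong (λ b → mask b (w v)) (lookup-fullSet v)) ⟨
      restrict w (inNbhd E R) v + restrict w (fullSet n) v ∎

    weight-nbhd : weight (splitWeight w) N ≡ weight w (inNbhd E R) + weight w (fullSet n)
    weight-nbhd = begin
      weight (splitWeight w) N
        ≡⟨ weight≡∑restrict (splitWeight w) N ⟩
      ∑ w′
        ≡⟨ sum-↑ +-0-monoid n {n} w′ ⟩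
      ∑ (w′ ∘ vOut {n}) + ∑ (w′ ∘ vIn {n})
        ≡⟨ ℕ-Sum.∑-distrib-+ {n} (w′ ∘ vOut {n}) (w′ ∘ vIn {n}) ⟨
      ∑ (λ (v : Fin n) → w′ (vOut v) + w′ (vIn v))
        ≡⟨ ℕ-Sum.sum-cong-≗ {n} restrict-vOut+vIn ⟩
      ∑ (λ v → restrict w I v + restrict w V v)
        ≡⟨ ℕ-Sum.∑-distrib-+ (restrict w I) (restrict w V) ⟩
      ∑ (restrict w I) + ∑ (restrict w V)
        ≡⟨ cong₂ _+_ (weight≡∑restrict w I) (weight≡∑restrict w V) ⟨
      weight w I + weight w V ∎
      where
      w′ : Fin (n + n) → ℕ
      w′ = restrict (splitWeight w) N
      I V : Subset n
      I = inNbhd E R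
      V = fullSet n

lemma3p4 : (n : ℕ) (E : Fin n → Fin n → Bool) (w : Fin n → ℕ) →
    (∀ v → 0 < w v) →
    (Rin : Subset (n + n)) → Nonempty Rin →
    (∀ a → a ∈ Rin → ∃ λ v → a ≡ vIn {n} v) →
    weight (splitWeight w) (nbhd (splitAdj E) Rin)
      ≡ weight w (inNbhd E (projIn Rin)) + weight w (fullSet n)
lemma3p4 n E w _ Rin (a , a∈Rin) Rin⊆Vin with Rin⊆Vin a a∈Rin
... | u₀ , refl = weight-nbhd w (trans (lookup-R u₀) ([]=⇒lookup a∈Rin))
  where open SplitGraph E Rin Rin⊆Vin
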